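{- Let $S_n$ be the star graph on $n\ge 3$ vertices and let $t,r$ be positive integers with $t>r$. Then $\mathcal{D}_{t,r}(S_n)=[1,n-1]$.
   Context: The star $S_n$ consists of one central vertex adjacent to $n-1$ leaves. An orientation assigns to every edge exactly one direction. For vertices $u,v$ of an oriented graph, $d(u,v)$ is the minimum length of a directed path from $u$ to $v$ ($d(u,u)=0$; $\infty$ if none exists). Given positive integers $t,r$ and $S\subseteq V$, the directed reception at $w$ is $\vec{r}(w)=\sum_{v\in S,\ d(v,w)<t}(t-d(v,w))$; $S$ is a directed $(t,r)$ broadcast dominating set if $\vec{r}(w)\ge r$ for every vertex $w$, and $\gamma_{t,r}(\vec{G})$ is its minimum cardinality. $\mathcal{D}_{t,r}(G)$ is the integer interval $[d,D]$ where $d$ and $D$ are the minimum and maximum of $\gamma_{t,r}(\vec{G})$ over all orientations $\vec{G}$ of $G$. -}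

module Defs where

open import Data.Nat using (ℕ; zero; suc; _+_; _∸_; _≤_; _<ᵇ_)
open import Data.Bool using (Bool; true; false; _∧_; _∨_; if_then_else_)
open import Data.Fin using (Fin; zero; suc)
open import Data.Fin.Properties using (_≟_)
open import Data.Fin.Subset using (Subset; _∈_; ∣_∣)
open import Data.Fin.Subset.Properties using (_∈?_)
open import Data.List using (List; []; _∷_; length; map; filter; lookup)
open import Data.Bool.ListAction using (any)
open import Data.Nat.ListAction using (sum)
open import Relation.Binary.PropositionalEquality using (_≡_)
open import Data.List using (allFin)
open import Data.Maybe using (Maybe; just; nothing)
open import Data.Product using (_×_; _,_; ∃; ∃-syntax)
open import Relation.Nullary.Decidable using (⌊_⌋)

-- A (simple, undirected) graph on vertex set Fin n, given by its list of edges.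
Graph : ℕ → Set
Graph n = List (Fin n × Fin n)

star : (n : ℕ) → Graph n
star zero    = []
star (suc m) = map (λ i → (zero , suc i)) (allFin m)

-- An orientation assigns a direction to every edge:
-- true means the edge (u , v) is oriented u → v, false means v → u.
Orientation : {n : ℕ} → Graph n → Set
Orientation G = Fin (length G) → Bool

arc : {n : ℕ} (G : Graph n) → Orientation G → Fin n → Fin n → Bool
arc G o x y = any (λ i → check (lookup G i) (o i)) (allFin (length G))
  where
  check : _ → Bool → Bool
  check (u , v) true  = ⌊ u ≟ x ⌋ ∧ ⌊ v ≟ y ⌋
  check (u , v) false = ⌊ v ≟ x ⌋ ∧ ⌊ u ≟ y ⌋

reach : {n : ℕ} (G : Graph n) → Orientation G → ℕ → Fin n → Fin n → Bool
reach G o zero    x y = ⌊ x ≟ y ⌋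
reach {n} G o (suc k) x y =
  reach G o k x y ∨ any (λ z → reach G o k x z ∧ arc G o z y) (allFin n)

-- directed distance d(x,y): least length of a directed path from x to y
-- (nothing = ∞).  A shortest walk is a path, of length < n.
dist : {n : ℕ} (G : Graph n) → Orientation G → Fin n → Fin n → Maybe ℕ
dist {n} G o x y = search 0 n
  where
  search : ℕ → ℕ → Maybe ℕ
  search k zero    = if reach G o k x y then just k else nothing
  search k (suc f) = if reach G o k x y then just k else search (suc k) f

contrib : ℕ → Maybe ℕ → ℕ
contrib t nothing  = 0
contrib t (just d) = if d <ᵇ t then t ∸ d else 0

reception : {n : ℕ} (G : Graph n) → Orientation G → ℕ → Subset n → Fin n → ℕ
reception {n} G o t S w =
  sum (map (λ v → contrib t (dist G o v w)) (filter (λ v → v ∈? S) (allFin n)))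

IsBroadcastDom : {n : ℕ} (G : Graph n) → Orientation G → ℕ → ℕ → Subset n → Set
IsBroadcastDom G o t r S = ∀ w → r ≤ reception G o t S w

IsGamma : {n : ℕ} (G : Graph n) → Orientation G → ℕ → ℕ → ℕ → Set
IsGamma G o t r k =
  (∃[ S ] (IsBroadcastDom G o t r S × ∣ S ∣ ≡ k))
  × (∀ S → IsBroadcastDom G o t r S → k ≤ ∣ S ∣)

-- 𝒟_{t,r}(G) = [d , D]: d (resp. D) is the minimum (resp. maximum) of
-- γ_{t,r}(G⃗) over all orientations G⃗ of G.
DomInterval : {n : ℕ} (G : Graph n) → ℕ → ℕ → ℕ → ℕ → Set
DomInterval G t r d D =
  ((∃[ o ] IsGamma G o t r d) × (∀ o k → IsGamma G o t r k → d ≤ k))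
  × ((∃[ o ] IsGamma G o t r D) × (∀ o k → IsGamma G o t r k → k ≤ D))

-- Because t > r, a vertex in S receives t ≥ r from itself and a vertex with an in-neighbour in S
-- receives t ∸ 1 ≥ r from it, so any set dominating along arcs is a broadcast dominating set;
-- conversely, since r ≥ 1, a vertex that no other vertex can reach must itself lie in S.
-- Orienting the star away from the centre, the centre alone dominates, while r ≥ 1 forbids S = ∅;
-- so γ = 1 there. In any orientation the edge from the centre to one leaf points into one of its ends a,
-- and the complement of a dominates, so γ ≤ n ∸ 1. Orienting the star into the centre, no leaf
-- is reachable from another vertex, so all n ∸ 1 leaves lie in every broadcast dominating set.
module Submission where

open import Defs
open import Data.Nat using (ℕ; zero; suc; _+_; _∸_; _≤_; _<_; z≤n; s≤s; z<s)
open import Data.Nat.Properties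
  using (≤-trans; <-≤-trans; <⇒≤; m≤n+m; m≤m+n; m<m+n; ∸-monoˡ-≤; m+n∸m≡n; <⇒<ᵇ)
open import Data.Bool using (Bool; true; false; T; _∧_; _∨_; if_then_else_)
open import Data.Bool.Properties using (T-∧; T-∨; T-≡)
open import Data.Fin using (Fin; zero; suc)
open import Data.Fin.Properties using (_≟_)
open import Data.Fin.Subset using (Subset; ⁅_⁆; ∁; ∣_∣; _⊆_; _∈_; Nonempty)
open import Data.Fin.Subset.Properties
  using (_∈?_; nonempty?; ∣⁅x⁆∣≡1; ∣∁p∣≡n∸∣p∣; x∈⁅x⁆; x∈⁅y⁆⇒x≡y; x∉p⇒x∈∁p; x∈∁p⇒x∉p;
         p⊆q⇒∣p∣≤∣q∣; x∈p⇒∣p-x∣<∣p∣)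
open import Data.List using ([]; _∷_; map; lookup; allFin)
open import Data.List.Membership.Propositional using (lose; find) renaming (_∈_ to _∈ₗ_)
open import Data.List.Membership.Propositional.Properties
  using (∈-allFin; ∈-filter⁺; ∈-filter⁻; ∈-map⁺; ∈-map⁻; ∈-lookup)
open import Data.List.Relation.Unary.Any using (here; there; index)
open import Data.List.Relation.Unary.Any.Properties using (any⁺; any⁻; lookup-index)
open import Data.Nat.ListAction using (sum)
open import Data.Maybe using (Maybe; just; nothing)
open import Data.Product using (_×_; _,_; ∃-syntax; proj₁; proj₂)
open import Data.Sum using (_⊎_; inj₁; inj₂)
open import Function using (_∘_)
open import Function.Bundles using (Equivalence)
open import Relation.Nullary using (¬_; yes; no; contradiction)
open import Relation.Nullary.Decidable using (⌊_⌋; fromWitness; toWitness)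
open import Relation.Binary.PropositionalEquality
  using (_≡_; _≢_; refl; sym; trans; cong; cong₂; subst)

open Equivalence

∈⇒≤sum-map : ∀ {A : Set} (f : A → ℕ) {x xs} → x ∈ₗ xs → f x ≤ sum (map f xs)
∈⇒≤sum-map f (here refl) = m≤m+n _ _
∈⇒≤sum-map f {xs = y ∷ _} (there x∈xs) = ≤-trans (∈⇒≤sum-map f x∈xs) (m≤n+m _ (f y))

sum-map-≡0 : ∀ {A : Set} (f : A → ℕ) xs → (∀ {x} → x ∈ₗ xs → f x ≡ 0) → sum (map f xs) ≡ 0
sum-map-≡0 f []       _    = refl
sum-map-≡0 f (x ∷ xs) f≡0 rewrite f≡0 (here refl) = sum-map-≡0 f xs (f≡0 ∘ there)

T-∨ˡ : ∀ {a} b → T a → T (a ∨ b)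
T-∨ˡ {true} _ _ = _

¬T⇒≡false : ∀ {b} → ¬ T b → b ≡ false
¬T⇒≡false {false} _  = refl
¬T⇒≡false {true}  ¬t = contradiction _ ¬t

T-≟∧≟-refl : ∀ {n} (u v : Fin n) → T (⌊ u ≟ u ⌋ ∧ ⌊ v ≟ v ⌋)
T-≟∧≟-refl u v with u ≟ u | v ≟ v
... | yes _   | yes _   = _
... | no u≢u  | _       = contradiction refl u≢u
... | yes _   | no v≢v  = contradiction refl v≢v

T-≟∧≟⁻ : ∀ {n} (a b u v : Fin n) → T (⌊ a ≟ u ⌋ ∧ ⌊ b ≟ v ⌋) → a ≡ u × b ≡ v
T-≟∧≟⁻ a b u v t with a ≟ u | b ≟ v
... | yes a≡u | yes b≡v = a≡u , b≡v

forwards backwards : ∀ {n} (G : Graph n) → Orientation G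
forwards  _ _ = true
backwards _ _ = false

arc-forwards⁺ : ∀ {n} {G : Graph n} {u v} → (u , v) ∈ₗ G → T (arc G (forwards G) u v)
arc-forwards⁺ {G = G} {u} {v} uv∈G = any⁺ _ (lose (∈-allFin (index uv∈G)) matches)
  where
  matches : T (⌊ proj₁ (lookup G (index uv∈G)) ≟ u ⌋ ∧ ⌊ proj₂ (lookup G (index uv∈G)) ≟ v ⌋)
  matches = subst (λ e → T (⌊ proj₁ e ≟ u ⌋ ∧ ⌊ proj₂ e ≟ v ⌋)) (lookup-index uv∈G) (T-≟∧≟-refl u v)

arc-backwards⁻ : ∀ {n} {G : Graph n} {x y} → T (arc G (backwards G) x y) → (y , x) ∈ₗ G
arc-backwards⁻ {G = G} {x} {y} a with find (any⁻ _ (allFin _) a)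
... | i , _ , hit with T-≟∧≟⁻ (proj₂ (lookup G i)) (proj₁ (lookup G i)) x y hit
...   | v≡x , u≡y = subst (_∈ₗ G) (cong₂ _,_ u≡y v≡x) (∈-lookup i)

head-edge-oriented : ∀ {n} {u v : Fin n} {G′} (G : Graph n) → G ≡ (u , v) ∷ G′ → (o : Orientation G)
  → T (arc G o u v) ⊎ T (arc G o v u)
head-edge-oriented {u = u} {v} _ refl o with o zero
... | true  = inj₁ (T-∨ˡ _ (T-≟∧≟-refl u v))
... | false = inj₂ (T-∨ˡ _ (T-≟∧≟-refl v u))

reach-arc : ∀ {n} (G : Graph n) (o : Orientation G) {x y} → T (arc G o x y) → T (reach G o 1 x y)
reach-arc G o {x} a =
  T-∨ .from (inj₂ (any⁺ _ (lose (∈-allFin x) (T-∧ {⌊ x ≟ x ⌋} .from (fromWitness refl , a)))))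

reach-without-in-arcs : ∀ {n} (G : Graph n) (o : Orientation G) {x y} → x ≢ y
  → (∀ z → ¬ T (arc G o z y)) → ∀ k → ¬ T (reach G o k x y)
reach-without-in-arcs G o x≢y no-arc zero    r = x≢y (toWitness r)
reach-without-in-arcs {n} G o x≢y no-arc (suc k) r with T-∨ .to r
... | inj₁ r′ = reach-without-in-arcs G o x≢y no-arc k r′
... | inj₂ r′ with find (any⁻ _ (allFin n) r′)
...   | z , _ , hit = no-arc z (proj₂ (T-∧ .to hit))

search-nothing : (R : ℕ → Bool) (s : ℕ → ℕ → Maybe ℕ) → (∀ k → ¬ T (R k))
  → (∀ k → s k zero ≡ (if R k then just k else nothing))
  → (∀ k f → s k (suc f) ≡ (if R k then just k else s (suc k) f))
  → ∀ k f → s k f ≡ nothing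
search-nothing R s never base step k zero
  rewrite base k | ¬T⇒≡false (never k) = refl
search-nothing R s never base step k (suc f)
  rewrite step k f | ¬T⇒≡false (never k) = search-nothing R s never base step (suc k) f

-- The search loop local to dist cannot be named, so distSearch is left to unification with it;
-- abstracting the graph size, the fuel and the start index first makes that a pattern problem.
mutual
  distSearch : ∀ {n} (G : Graph n) (o : Orientation G) (x y : Fin n) → ℕ → ℕ → Maybe ℕ
  distSearch = _

  dist-unreachable : ∀ {n} (G : Graph n) (o : Orientation G) {x y}
    → (∀ k → ¬ T (reach G o k x y)) → dist G o x y ≡ nothing
  dist-unreachable {suc m} G o {x} {y} never rewrite ¬T⇒≡false (never 0) with suc m
  ... | N with m | 1
  ... | fuel | k = search-nothing (λ k → reach G o k x y) (distSearch {N} G o x y) never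
                     (λ _ → refl) (λ _ _ → refl) k fuel

dist-self : ∀ {n} (G : Graph n) (o : Orientation G) (x : Fin n) → dist G o x x ≡ just 0
dist-self {suc _} G o x with x ≟ x
... | yes _   = refl
... | no x≢x = contradiction refl x≢x

dist-arc : ∀ {n} (G : Graph n) (o : Orientation G) {x y} → x ≢ y → T (arc G o x y) → dist G o x y ≡ just 1
dist-arc {suc zero} G o {zero} {zero} x≢y _ = contradiction refl x≢y
dist-arc {suc (suc _)} G o {x} {y} x≢y a
  rewrite T-≡ .to (reach-arc G o a) | ¬T⇒≡false {⌊ x ≟ y ⌋} (x≢y ∘ toWitness) = refl

contrib-within : ∀ {t d} → d < t → contrib t (just d) ≡ t ∸ d
contrib-within {t} {d} d<t rewrite T-≡ .to (<⇒<ᵇ d<t) = refl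

≤-contrib : ∀ {t d r} → d + r ≤ t → r ≤ contrib t (just d)
≤-contrib {r = zero}          _       = z≤n
≤-contrib {t} {d} {suc r} d+r≤t rewrite contrib-within (<-≤-trans (m<m+n d z<s) d+r≤t) =
  subst (_≤ t ∸ d) (m+n∸m≡n d (suc r)) (∸-monoˡ-≤ d d+r≤t)

reception-≥-member : ∀ {n} (G : Graph n) (o : Orientation G) t {S} w {v} → v ∈ S
  → contrib t (dist G o v w) ≤ reception G o t S w
reception-≥-member G o t {S} w v∈S =
  ∈⇒≤sum-map _ (∈-filter⁺ (_∈? S) (∈-allFin _) v∈S)

reception-≡0 : ∀ {n} (G : Graph n) (o : Orientation G) t {S} w
  → (∀ {v} → v ∈ S → contrib t (dist G o v w) ≡ 0) → reception G o t S w ≡ 0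
reception-≡0 G o t {S} w silent =
  sum-map-≡0 _ _ (silent ∘ proj₂ ∘ ∈-filter⁻ (_∈? S) {xs = allFin _})

IsDominating : ∀ {n} (G : Graph n) → Orientation G → Subset n → Set
IsDominating {n} G o S = ∀ (w : Fin n) → w ∈ S ⊎ ∃[ v ] (v ∈ S × v ≢ w × T (arc G o v w))

IsDominating⇒IsBroadcastDom : ∀ {n} (G : Graph n) (o : Orientation G) {t r S} → r < t
  → IsDominating G o S → IsBroadcastDom G o t r S
IsDominating⇒IsBroadcastDom G o {t} r<t dom w with dom w
... | inj₁ w∈S = ≤-trans (subst (_ ≤_) (cong (contrib t) (sym (dist-self G o w))) (≤-contrib (<⇒≤ r<t)))
                         (reception-≥-member G o t w w∈S)
... | inj₂ (v , v∈S , v≢w , v→w) =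
  ≤-trans (subst (_ ≤_) (cong (contrib t) (sym (dist-arc G o v≢w v→w))) (≤-contrib r<t))
          (reception-≥-member G o t w v∈S)

⁅⁆-dominating : ∀ {n} (G : Graph n) (o : Orientation G) {a}
  → (∀ w → a ≢ w → T (arc G o a w)) → IsDominating G o ⁅ a ⁆
⁅⁆-dominating G o {a} a→ w with a ≟ w
... | yes refl = inj₁ (x∈⁅x⁆ a)
... | no a≢w  = inj₂ (a , x∈⁅x⁆ a , a≢w , a→ w a≢w)

∁⁅⁆-dominating : ∀ {n} (G : Graph n) (o : Orientation G) {a b}
  → b ≢ a → T (arc G o b a) → IsDominating G o (∁ ⁅ a ⁆)
∁⁅⁆-dominating G o {a} {b} b≢a b→a w with w ≟ a
... | yes refl = inj₂ (b , x∉p⇒x∈∁p (b≢a ∘ x∈⁅y⁆⇒x≡y a) , b≢a , b→a)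
... | no w≢a  = inj₁ (x∉p⇒x∈∁p (w≢a ∘ x∈⁅y⁆⇒x≡y a))

∣∁⁅x⁆∣≡n∸1 : ∀ {n} (x : Fin n) → ∣ ∁ ⁅ x ⁆ ∣ ≡ n ∸ 1
∣∁⁅x⁆∣≡n∸1 {n} x = trans (∣∁p∣≡n∸∣p∣ ⁅ x ⁆) (cong (n ∸_) (∣⁅x⁆∣≡1 x))

Nonempty⇒1≤∣p∣ : ∀ {n} {p : Subset n} → Nonempty p → 1 ≤ ∣ p ∣
Nonempty⇒1≤∣p∣ (_ , x∈p) = <-≤-trans (s≤s z≤n) (x∈p⇒∣p-x∣<∣p∣ x∈p)

reception≢0 : ∀ {n} (G : Graph n) (o : Orientation G) {t r S} → 1 ≤ r
  → IsBroadcastDom G o t r S → ∀ w → reception G o t S w ≢ 0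
reception≢0 G o 1≤r dom w silent with ≤-trans 1≤r (subst (_ ≤_) silent (dom w))
... | ()

IsBroadcastDom⇒Nonempty : ∀ {n} (G : Graph (suc n)) (o : Orientation G) {t r S} → 1 ≤ r
  → IsBroadcastDom G o t r S → Nonempty S
IsBroadcastDom⇒Nonempty G o {t} {S = S} 1≤r dom with nonempty? S
... | yes ne = ne
... | no empty =
  contradiction (reception-≡0 G o t zero (λ v∈S → contradiction (_ , v∈S) empty)) (reception≢0 G o {S = S} 1≤r dom zero)

unreachable-∈ : ∀ {n} (G : Graph n) (o : Orientation G) {t r S w} → 1 ≤ r
  → (∀ z → ¬ T (arc G o z w)) → IsBroadcastDom G o t r S → w ∈ S
unreachable-∈ G o {t} {S = S} {w} 1≤r no-arc dom with w ∈? S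
... | yes w∈S = w∈S
... | no w∉S = contradiction (reception-≡0 G o t w silent) (reception≢0 G o {S = S} 1≤r dom w)
  where
  silent : ∀ {v} → v ∈ S → contrib t (dist G o v w) ≡ 0
  silent {v} v∈S = cong (contrib t)
    (dist-unreachable G o (reach-without-in-arcs G o (λ { refl → w∉S v∈S }) no-arc))

DomInterval-intro : ∀ {n} {G : Graph n} {t r d D}
  → (∀ o S → IsBroadcastDom G o t r S → d ≤ ∣ S ∣)
  → (∀ o → ∃[ S ] (IsBroadcastDom G o t r S × ∣ S ∣ ≡ D))
  → ∃[ o ] ∃[ S ] (IsBroadcastDom G o t r S × ∣ S ∣ ≡ d)
  → ∃[ o ] (∀ S → IsBroadcastDom G o t r S → D ≤ ∣ S ∣)
  → DomInterval G t r d D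
DomInterval-intro {d = d} {D} lower upper (o₁ , smallest) (o₂ , minimal₂) =
  ((o₁ , smallest , lower o₁) , γ≥d) , ((o₂ , upper o₂ , minimal₂) , γ≤D)
  where
  γ≥d : ∀ o k → IsGamma _ o _ _ k → d ≤ k
  γ≥d o _ ((S , dom , refl) , _) = lower o S dom
  γ≤D : ∀ o k → IsGamma _ o _ _ k → k ≤ D
  γ≤D o k (_ , minimal) with upper o
  ... | S , dom , refl = minimal S dom

∈-star : ∀ {m} (j : Fin m) → (zero , suc j) ∈ₗ star (suc m)
∈-star j = ∈-map⁺ (λ i → (zero , suc i)) (∈-allFin j)

∈-star⁻ : ∀ {m} {u v : Fin (suc m)} → (u , v) ∈ₗ star (suc m) → u ≡ zero
∈-star⁻ uv∈star with ∈-map⁻ (λ i → (zero , suc i)) uv∈star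
... | _ , _ , refl = refl

centre-dominates-out-star : ∀ m → IsDominating (star (suc m)) (forwards (star (suc m))) ⁅ zero ⁆
centre-dominates-out-star m = ⁅⁆-dominating (star (suc m)) (forwards (star (suc m))) centre→
  where
  centre→ : ∀ w → zero ≢ w → T (arc (star (suc m)) (forwards (star (suc m))) zero w)
  centre→ zero    0≢0 = contradiction refl 0≢0
  centre→ (suc j) _   = arc-forwards⁺ (∈-star j)

leaves⊆dominating-in-star : ∀ m {t r S} → 1 ≤ r
  → IsBroadcastDom (star (suc m)) (backwards (star (suc m))) t r S → ∁ ⁅ zero ⁆ ⊆ S
leaves⊆dominating-in-star m 1≤r dom {zero}  0∈∁ = contradiction (x∈⁅x⁆ zero) (x∈∁p⇒x∉p 0∈∁)
leaves⊆dominating-in-star m {t} {r} {S} 1≤r dom {suc j} _   =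
  unreachable-∈ (star (suc m)) (backwards (star (suc m))) {t} {r} {S} 1≤r no-arc-into-leaf dom
  where
  no-arc-into-leaf : ∀ z → ¬ T (arc (star (suc m)) (backwards (star (suc m))) z (suc j))
  no-arc-into-leaf z z→leaf with ∈-star⁻ (arc-backwards⁻ {G = star (suc m)} z→leaf)
  ... | ()

star-co-singleton-dominating : ∀ m (o : Orientation (star (suc (suc m))))
  → ∃[ a ] IsDominating (star (suc (suc m))) o (∁ ⁅ a ⁆)
star-co-singleton-dominating m o with head-edge-oriented (star (suc (suc m))) refl o
... | inj₁ 0→1 = suc zero , ∁⁅⁆-dominating (star (suc (suc m))) o {a = suc zero} (λ ()) 0→1
... | inj₂ 1→0 = zero     , ∁⁅⁆-dominating (star (suc (suc m))) o {a = zero} (λ ()) 1→0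

mainTheorem7 : (n t r : ℕ) → 3 ≤ n → 1 ≤ r → r < t →
    DomInterval (star n) t r 1 (n ∸ 1)
mainTheorem7 (suc (suc m)) t r (s≤s (s≤s _)) 1≤r r<t =
  DomInterval-intro nonempty co-singleton out-star in-star
  where
  G = star (suc (suc m))
  toBroadcast : ∀ o {S} → IsDominating G o S → IsBroadcastDom G o t r S
  toBroadcast o = IsDominating⇒IsBroadcastDom G o r<t
  nonempty : ∀ o S → IsBroadcastDom G o t r S → 1 ≤ ∣ S ∣
  nonempty o S dom = Nonempty⇒1≤∣p∣ (IsBroadcastDom⇒Nonempty G o {t} {r} {S} 1≤r dom)
  co-singleton : ∀ o → ∃[ S ] (IsBroadcastDom G o t r S × ∣ S ∣ ≡ suc m)
  co-singleton o with star-co-singleton-dominating m o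
  ... | a , dom = ∁ ⁅ a ⁆ , toBroadcast o dom , ∣∁⁅x⁆∣≡n∸1 a
  out-star : ∃[ o ] ∃[ S ] (IsBroadcastDom G o t r S × ∣ S ∣ ≡ 1)
  out-star = forwards G , ⁅ zero ⁆ , toBroadcast (forwards G) (centre-dominates-out-star (suc m)) , ∣⁅x⁆∣≡1 {suc (suc m)} zero
  in-star : ∃[ o ] (∀ S → IsBroadcastDom G o t r S → suc m ≤ ∣ S ∣)
  in-star = backwards G , λ S dom → subst (_≤ ∣ S ∣) (∣∁⁅x⁆∣≡n∸1 {suc (suc m)} zero)
    (p⊆q⇒∣p∣≤∣q∣ (leaves⊆dominating-in-star (suc m) {t} {r} {S} 1≤r dom))
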